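{- Let $\Sigma_r=\{0,1,-,+,\cdot\}$ (constants $0,1$, unary minus $-$, binary $+$ and $\cdot$). The term rewriting system $D_1$ obtained by orienting the following twelve equations from left to right is strongly terminating: [R1] $x+0=x$; [R2] $0+x=x$; [R3] $x+(y+z)=(x+y)+z$; [R4] $x\cdot 0=0$; [R5] $x\cdot 1=x$; [R6] $x\cdot(y+z)=(x\cdot y)+(x\cdot z)$; [R7] $-0=0$; [R8] $(-1)+1=0$; [R9] $(-(x+1))+1=-x$; [R10] $-(-x)=x$; [R11] $x+(-y)=-((-x)+y)$; [R12] $x\cdot(-y)=-(x\cdot y)$.
   Context: Each equation is read as a rewrite rule from left to right, where $x,y,z$ are variables. Strongly terminating means there is no infinite rewrite sequence. -}

module Defs where

open import Data.Nat using (ℕ; suc)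
open import Data.Product using (∃)
open import Relation.Nullary using (¬_)

data Term : Set where
  var  : ℕ → Term
  𝟎    : Term
  𝟏    : Term
  neg  : Term → Term
  _⊕_  : Term → Term → Term
  _⊙_  : Term → Term → Term

infixl 6 _⊕_
infixl 7 _⊙_

_⟨_⟩ : Term → (ℕ → Term) → Term
var n   ⟨ σ ⟩ = σ n
𝟎       ⟨ σ ⟩ = 𝟎
𝟏       ⟨ σ ⟩ = 𝟏
neg t   ⟨ σ ⟩ = neg (t ⟨ σ ⟩)
(s ⊕ t) ⟨ σ ⟩ = (s ⟨ σ ⟩) ⊕ (t ⟨ σ ⟩)
(s ⊙ t) ⟨ σ ⟩ = (s ⟨ σ ⟩) ⊙ (t ⟨ σ ⟩)

x y z : Term
x = var 0
y = var 1
z = var 2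

data Rule : Set where
  R1 R2 R3 R4 R5 R6 R7 R8 R9 R10 R11 R12 : Rule

lhs rhs : Rule → Term
lhs R1  = x ⊕ 𝟎
lhs R2  = 𝟎 ⊕ x
lhs R3  = x ⊕ (y ⊕ z)
lhs R4  = x ⊙ 𝟎
lhs R5  = x ⊙ 𝟏
lhs R6  = x ⊙ (y ⊕ z)
lhs R7  = neg 𝟎
lhs R8  = neg 𝟏 ⊕ 𝟏
lhs R9  = neg (x ⊕ 𝟏) ⊕ 𝟏
lhs R10 = neg (neg x)
lhs R11 = x ⊕ neg y
lhs R12 = x ⊙ neg y
rhs R1  = x
rhs R2  = x
rhs R3  = (x ⊕ y) ⊕ z
rhs R4  = 𝟎
rhs R5  = x
rhs R6  = (x ⊙ y) ⊕ (x ⊙ z)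
rhs R7  = 𝟎
rhs R8  = 𝟎
rhs R9  = neg x
rhs R10 = x
rhs R11 = neg (neg x ⊕ y)
rhs R12 = neg (x ⊙ y)

data _⟶_ : Term → Term → Set where
  root : (ρ : Rule) (σ : ℕ → Term) → (lhs ρ ⟨ σ ⟩) ⟶ (rhs ρ ⟨ σ ⟩)
  neg-cong : ∀ {s t} → s ⟶ t → neg s ⟶ neg t
  ⊕-congˡ  : ∀ {s t u} → s ⟶ t → (s ⊕ u) ⟶ (t ⊕ u)
  ⊕-congʳ  : ∀ {s t u} → s ⟶ t → (u ⊕ s) ⟶ (u ⊕ t)
  ⊙-congˡ  : ∀ {s t u} → s ⟶ t → (s ⊙ u) ⟶ (t ⊙ u)
  ⊙-congʳ  : ∀ {s t u} → s ⟶ t → (u ⊙ s) ⟶ (u ⊙ t)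

infix 4 _⟶_

StronglyTerminating : Set
StronglyTerminating = ¬ (∃ λ (f : ℕ → Term) → ∀ n → f n ⟶ f (suc n))

-- A polynomial interpretation into ℕ in which every operation is strictly
-- monotone in each argument and every rule instance strictly decreases:
-- 0 and 1 denote 0, - x denotes x + 1, x + y denotes x + 3y + 7 and
-- x · y denotes xy + 2x + 2y + 2.  A rewrite step therefore lowers the value
-- of a term, and an infinite rewrite sequence would give an infinite
-- descending sequence in ℕ.
module Submission where

open import Defs
open import Data.Nat
open import Data.Nat.Properties
open import Data.Nat.Induction using (<-wellFounded)
open import Data.Nat.Tactic.RingSolver using (solve-∀)
open import Data.Product using (_,_)
open import Function using (_∘_)
open import Induction.InfiniteDescent using (InfiniteDescendingSequence)
open import Induction.WellFounded using (WellFounded; Acc; acc)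
open import Relation.Binary.Core using (Rel)
open import Relation.Binary.PropositionalEquality using (_≡_; refl; cong; cong₂)
open import Relation.Nullary using (¬_)

acc⇒¬infiniteDescendingSequence : ∀ {a r} {A : Set a} {_<_ : Rel A r} {f : ℕ → A} →
                                   Acc _<_ (f 0) → ¬ InfiniteDescendingSequence _<_ f
acc⇒¬infiniteDescendingSequence (acc rs) descending =
  acc⇒¬infiniteDescendingSequence (rs (descending 0)) (descending ∘ suc)

wf⇒¬infiniteDescendingSequence : ∀ {a r} {A : Set a} {_<_ : Rel A r} → WellFounded _<_ →
                                  ∀ f → ¬ InfiniteDescendingSequence _<_ f
wf⇒¬infiniteDescendingSequence wf f = acc⇒¬infiniteDescendingSequence (wf (f 0))

⟦⊕⟧ ⟦⊙⟧ : ℕ → ℕ → ℕ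
⟦⊕⟧ a b = a + 3 * b + 7
⟦⊙⟧ a b = a * b + 2 * a + 2 * b + 2

⟦_⟧ : Term → (ℕ → ℕ) → ℕ
⟦ var n ⟧ e = e n
⟦ 𝟎 ⟧     e = 0
⟦ 𝟏 ⟧     e = 0
⟦ neg t ⟧ e = suc (⟦ t ⟧ e)
⟦ s ⊕ t ⟧ e = ⟦⊕⟧ (⟦ s ⟧ e) (⟦ t ⟧ e)
⟦ s ⊙ t ⟧ e = ⟦⊙⟧ (⟦ s ⟧ e) (⟦ t ⟧ e)

⟦⊕⟧-monoˡ-< : ∀ b {a a′} → a < a′ → ⟦⊕⟧ a b < ⟦⊕⟧ a′ b
⟦⊕⟧-monoˡ-< b a<a′ = +-monoˡ-< 7 (+-monoˡ-< (3 * b) a<a′)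

⟦⊕⟧-monoʳ-< : ∀ a {b b′} → b < b′ → ⟦⊕⟧ a b < ⟦⊕⟧ a b′
⟦⊕⟧-monoʳ-< a b<b′ = +-monoˡ-< 7 (+-monoʳ-< a (*-monoʳ-< 3 b<b′))

⟦⊙⟧-monoˡ-< : ∀ b {a a′} → a < a′ → ⟦⊙⟧ a b < ⟦⊙⟧ a′ b
⟦⊙⟧-monoˡ-< b a<a′ =
  +-monoˡ-< 2 (+-monoˡ-< (2 * b) (+-mono-≤-< (*-monoˡ-≤ b (<⇒≤ a<a′)) (*-monoʳ-< 2 a<a′)))

⟦⊙⟧-monoʳ-< : ∀ a {b b′} → b < b′ → ⟦⊙⟧ a b < ⟦⊙⟧ a b′
⟦⊙⟧-monoʳ-< a b<b′ =
  +-monoˡ-< 2 (+-mono-≤-< (+-monoˡ-≤ (2 * a) (*-monoʳ-≤ a (<⇒≤ b<b′))) (*-monoʳ-< 2 b<b′))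

⟦⟨⟩⟧ : ∀ t σ e → ⟦ t ⟨ σ ⟩ ⟧ e ≡ ⟦ t ⟧ (λ n → ⟦ σ n ⟧ e)
⟦⟨⟩⟧ (var n) σ e = refl
⟦⟨⟩⟧ 𝟎       σ e = refl
⟦⟨⟩⟧ 𝟏       σ e = refl
⟦⟨⟩⟧ (neg t) σ e = cong suc (⟦⟨⟩⟧ t σ e)
⟦⟨⟩⟧ (s ⊕ t) σ e = cong₂ ⟦⊕⟧ (⟦⟨⟩⟧ s σ e) (⟦⟨⟩⟧ t σ e)
⟦⟨⟩⟧ (s ⊙ t) σ e = cong₂ ⟦⊙⟧ (⟦⟨⟩⟧ s σ e) (⟦⟨⟩⟧ t σ e)

n≡1+k+m⇒m<n : ∀ {m n} k → n ≡ suc (k + m) → m < n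
n≡1+k+m⇒m<n {m} k refl = m<n+m m z<s

-- The gaps are written with ⟦⊕⟧ and ⟦⊙⟧ unfolded, since the ring solver does
-- not look through definitions.
rule-decreasing : ∀ ρ e → ⟦ rhs ρ ⟧ e < ⟦ lhs ρ ⟧ e
rule-decreasing R1  e = n≡1+k+m⇒m<n 6 (gap (e 0))
  where gap : ∀ a → a + 3 * 0 + 7 ≡ suc (6 + a)
        gap = solve-∀
rule-decreasing R2  e = n≡1+k+m⇒m<n (2 * e 0 + 6) (gap (e 0))
  where gap : ∀ a → 0 + 3 * a + 7 ≡ suc ((2 * a + 6) + a)
        gap = solve-∀
rule-decreasing R3  e = n≡1+k+m⇒m<n (6 * e 2 + 13) (gap (e 0) (e 1) (e 2))
  where gap : ∀ a b c → a + 3 * (b + 3 * c + 7) + 7 ≡ suc ((6 * c + 13) + (a + 3 * b + 7 + 3 * c + 7))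
        gap = solve-∀
rule-decreasing R4  e = n≡1+k+m⇒m<n (2 * e 0 + 1) (gap (e 0))
  where gap : ∀ a → a * 0 + 2 * a + 2 * 0 + 2 ≡ suc ((2 * a + 1) + 0)
        gap = solve-∀
rule-decreasing R5  e = n≡1+k+m⇒m<n (e 0 + 1) (gap (e 0))
  where gap : ∀ a → a * 0 + 2 * a + 2 * 0 + 2 ≡ suc ((a + 1) + a)
        gap = solve-∀
rule-decreasing R6  e = n≡1+k+m⇒m<n (e 0) (gap (e 0) (e 1) (e 2))
  where gap : ∀ a b c → a * (b + 3 * c + 7) + 2 * a + 2 * (b + 3 * c + 7) + 2
              ≡ suc (a + ((a * b + 2 * a + 2 * b + 2) + 3 * (a * c + 2 * a + 2 * c + 2) + 7))
        gap = solve-∀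
rule-decreasing R7  e = n≡1+k+m⇒m<n 0 refl
rule-decreasing R8  e = n≡1+k+m⇒m<n 7 refl
rule-decreasing R9  e = n≡1+k+m⇒m<n 13 (gap (e 0))
  where gap : ∀ a → suc (a + 3 * 0 + 7) + 3 * 0 + 7 ≡ suc (13 + suc a)
        gap = solve-∀
rule-decreasing R10 e = n≡1+k+m⇒m<n 1 refl
rule-decreasing R11 e = n≡1+k+m⇒m<n 0 (gap (e 0) (e 1))
  where gap : ∀ a b → a + 3 * suc b + 7 ≡ suc (0 + suc (suc a + 3 * b + 7))
        gap = solve-∀
rule-decreasing R12 e = n≡1+k+m⇒m<n (e 0) (gap (e 0) (e 1))
  where gap : ∀ a b → a * suc b + 2 * a + 2 * suc b + 2 ≡ suc (a + suc (a * b + 2 * a + 2 * b + 2))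
        gap = solve-∀

⟶-decreasing : ∀ {s t} → s ⟶ t → ∀ e → ⟦ t ⟧ e < ⟦ s ⟧ e
⟶-decreasing (root ρ σ) e
  rewrite ⟦⟨⟩⟧ (lhs ρ) σ e | ⟦⟨⟩⟧ (rhs ρ) σ e = rule-decreasing ρ _
⟶-decreasing (neg-cong s⟶t)          e = s<s (⟶-decreasing s⟶t e)
⟶-decreasing (⊕-congˡ {u = u} s⟶t) e = ⟦⊕⟧-monoˡ-< (⟦ u ⟧ e) (⟶-decreasing s⟶t e)
⟶-decreasing (⊕-congʳ {u = u} s⟶t) e = ⟦⊕⟧-monoʳ-< (⟦ u ⟧ e) (⟶-decreasing s⟶t e)
⟶-decreasing (⊙-congˡ {u = u} s⟶t) e = ⟦⊙⟧-monoˡ-< (⟦ u ⟧ e) (⟶-decreasing s⟶t e)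
⟶-decreasing (⊙-congʳ {u = u} s⟶t) e = ⟦⊙⟧-monoʳ-< (⟦ u ⟧ e) (⟶-decreasing s⟶t e)

lemma2p1p1 : StronglyTerminating
lemma2p1p1 (f , steps) =
  wf⇒¬infiniteDescendingSequence <-wellFounded (λ n → ⟦ f n ⟧ (λ _ → 0))
    (λ n → ⟶-decreasing (steps n) (λ _ → 0))
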